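{- Let $(W,S)$ be a Coxeter system with $S=\{s_0,\ldots,s_n\}$ in which $s_0$ is an even leaf, let $W^+$, $R$, $\ell_{R\cup R^{ -1}}$ and the Coxeter system $(W',S')$, $S'=\{t_1',t_1,t_2,\ldots,t_n\}$, be as in the context, and let $\theta:W^+\to W'$ and $\Theta$ be as in the context. Then for every $w\in W^+$: (i) $\ell_{R\cup R^{ -1}}(w)=\ell_{S'}(\theta(w))$; (ii) $\Theta$ restricts to a bijection from the set of reduced $(R\cup R^{ -1})$-words for $w$ to the set of reduced $S'$-words for $\theta(w)$; (iii) the bijection $R\cup R^{ -1}\to S'$ given by $r_j\mapsto t_j$ for $j=2,\ldots,n$, and $r_1\mapsto t_1'$, $r_1^{ -1}\mapsto t_1$ if $\ell_{R\cup R^{ -1}}(w)$ is even, respectively $r_1\mapsto t_1$, $r_1^{ -1}\mapsto t_1'$ if $\ell_{R\cup R^{ -1}}(w)$ is odd, maps $\mathrm{Des}_{R\cup R^{ -1}}(w)$ bijectively onto $\mathrm{Des}_{S'}(\theta(w))$. Moreover: (iv) $\theta$ is a poset isomorphism from $(W^+,\le_{RW})$ to $W'$ with the right weak order of the Coxeter system $(W',S')$; (v) $\theta$ is a poset isomorphism from $(W^+,\le_{RS})$ to $W'$ with the (strong) Bruhat order of $(W',S')$.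
   Context: Coxeter system $(W,S)$, $S=\{s_0,\ldots,s_n\}$, with relations $s_i^2=e$, $(s_is_j)^{m_{ij}}=e$. $s_0$ is an even leaf: $m_{01}$ even (or $\infty$) and $m_{0j}=2$ for $j\ge2$. $W^+=\ker\epsilon$ where $\epsilon(s)=-1$ for $s\in S$; it is generated by $R=\{r_1,\ldots,r_n\}$, $r_i=s_0s_i$. $\ell_{R\cup R^{ -1}}(w)$ is the minimal length of a word in $R\cup R^{ -1}$ factoring $w$ (such minimal words are reduced). $\chi_0:W\to\{\pm1\}$ is the homomorphism with $\chi_0(s_0)=-1$, $\chi_0(s_j)=1$ ($j\ge1$), $W'=\ker\chi_0$, and $S'=\{t_1,\ldots,t_n,t_1'\}\subset W'$ with $t_j=s_j$ and $t_1'=s_0s_1s_0$; $(W',S')$ is a Coxeter system, with length function $\ell_{S'}$. $\theta:W^+\to W'$ sends $w$ to the unique element of $\{w,ws_0\}$ lying in $W'$. $\Theta$ maps a word $(r^{(1)},\ldots,r^{(\ell)})$ in $R\cup R^{ -1}$ letter by letter to a word in $S'$: the letter $r_j$ ($j\ge2$) goes to $t_j$; a letter $r_1$ in position $k$ goes to $t_1$ if $k$ is even and to $t_1'$ if $k$ is odd; a letter $r_1^{ -1}$ in position $k$ goes to $t_1'$ if $k$ is even and to $t_1$ if $k$ is odd. For $w\in W^+$, $\mathrm{Des}_{R\cup R^{ -1}}(w)=\{r\in R\cup R^{ -1}:\ell_{R\cup R^{ -1}}(wr)<\ell_{R\cup R^{ -1}}(w)\}$; for $u\in W'$, $\mathrm{Des}_{S'}(u)=\{t\in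 S':\ell_{S'}(ut)<\ell_{S'}(u)\}$. A palindrome in $W^+$ is an element factored by an odd-length word $(a_1,\ldots,a_\ell)$ in $R\cup R^{ -1}$ with $a_{\ell+1-i}=a_i$. The right weak order $\le_{RW}$ on $W^+$ is the reflexive transitive closure of $w\lessdot wr$ for $r\in R\cup R^{ -1}$ with $\ell_{R\cup R^{ -1}}(wr)=\ell_{R\cup R^{ -1}}(w)+1$; the right strong order $\le_{RS}$ on $W^+$ is the reflexive transitive closure of $w\to wp$ for palindromes $p$ with $\ell_{R\cup R^{ -1}}(w)<\ell_{R\cup R^{ -1}}(wp)$. -}

module Defs where

open import Data.Nat using (ℕ; zero; suc; _+_; _<_; _≤_)
open import Data.Fin using (Fin; zero; suc)
open import Data.List using (List; []; _∷_; _++_; length; reverse; concatMap)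
open import Data.Bool using (Bool; true; false; not; if_then_else_)
open import Data.Product using (Σ; _×_; _,_; ∃)
open import Data.Unit using (⊤)
open import Relation.Binary.PropositionalEquality using (_≡_; _≢_)

data ℕ∞ : Set where
  fin : ℕ → ℕ∞
  ∞   : ℕ∞

isEven : ℕ → Bool
isEven zero    = true
isEven (suc k) = not (isEven k)

-- Convention: generators s_0, s_1, ..., s_{n+1} are indexed by Fin (2 + n);
-- s_0 = zero, s_1 = suc zero, s_{j+2} = suc (suc j).
-- (So the paper's "n" is our  suc n ; the paper needs n ≥ 1 so that s_1 exists.)
CoxMatrix : ℕ → Set
CoxMatrix n = Fin (suc (suc n)) → Fin (suc (suc n)) → ℕ∞

AtLeast2 : ℕ∞ → Set
AtLeast2 (fin k) = 2 ≤ k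
AtLeast2 ∞       = ⊤

EvenOrInf : ℕ∞ → Set
EvenOrInf (fin k) = isEven k ≡ true
EvenOrInf ∞       = ⊤

record IsCoxeterMatrix {n : ℕ} (m : CoxMatrix n) : Set where
  field
    diag    : ∀ i → m i i ≡ fin 1
    symm    : ∀ i j → m i j ≡ m j i
    offdiag : ∀ i j → i ≢ j → AtLeast2 (m i j)

record EvenLeaf {n : ℕ} (m : CoxMatrix n) : Set where
  field
    even01 : EvenOrInf (m zero (suc zero))
    comm0j : ∀ j → m zero (suc (suc j)) ≡ fin 2

module Cox {n : ℕ} (m : CoxMatrix n) where

  Gen : Set
  Gen = Fin (suc (suc n))

  -- words in S; elements of W are represented by words up to _≈_
  Word : Set
  Word = List Gen

  alt : Gen → Gen → ℕ → Word
  alt i j zero    = []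
  alt i j (suc k) = i ∷ j ∷ alt i j k

  -- equality in W: congruence generated by the Coxeter relators (s_i s_j)^{m_ij}
  -- (for i = j this is s_i^2, since m_ii = 1); m_ij = ∞ imposes no relation
  infix 4 _≈_
  data _≈_ : Word → Word → Set where
    ≈refl  : ∀ {u} → u ≈ u
    ≈sym   : ∀ {u v} → u ≈ v → v ≈ u
    ≈trans : ∀ {u v w} → u ≈ v → v ≈ w → u ≈ w
    ≈rel   : ∀ u v i j k → m i j ≡ fin k → (u ++ (alt i j k ++ v)) ≈ (u ++ v)

  count0 : Word → ℕ
  count0 []            = 0
  count0 (zero ∷ w)    = suc (count0 w)
  count0 (suc _ ∷ w)   = count0 w

  -- w ∈ W⁺ = ker ε  (ε(w) = (-1)^{length})
  InW⁺ : Word → Set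
  InW⁺ w = isEven (length w) ≡ true

  -- u ∈ W' = ker χ₀ (χ₀(u) = (-1)^{number of s_0})
  InW' : Word → Set
  InW' u = isEven (count0 u) ≡ true

  θ : Word → Word
  θ w = if isEven (count0 w) then w else (w ++ (zero ∷ []))

  -- the alphabet R ∪ R⁻¹ : r_1, r_1⁻¹, and r_{j+2} (= r_{j+2}⁻¹) for j : Fin n
  data RL : Set where
    r1 r1⁻ : RL
    r      : Fin n → RL

  expR : RL → Word
  expR r1    = zero ∷ suc zero ∷ []
  expR r1⁻   = suc zero ∷ zero ∷ []
  expR (r j) = zero ∷ suc (suc j) ∷ []

  expRs : List RL → Word
  expRs = concatMap expR

  data SL : Set where
    t1 t1' : SL
    t      : Fin n → SL

  expS : SL → Word
  expS t1    = suc zero ∷ []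
  expS t1'   = zero ∷ suc zero ∷ zero ∷ []
  expS (t j) = suc (suc j) ∷ []

  expSs : List SL → Word
  expSs = concatMap expS

  LenR : Word → ℕ → Set
  LenR w k = (∃ λ a → length a ≡ k × expRs a ≈ w) × (∀ a → expRs a ≈ w → k ≤ length a)

  LenS : Word → ℕ → Set
  LenS u k = (∃ λ b → length b ≡ k × expSs b ≈ u) × (∀ b → expSs b ≈ u → k ≤ length b)

  ReducedR : Word → List RL → Set
  ReducedR w a = expRs a ≈ w × LenR w (length a)

  ReducedS : Word → List SL → Set
  ReducedS u b = expSs b ≈ u × LenS u (length b)

  -- Θ; the Bool records whether the current position is odd
  ΘAt : Bool → List RL → List SL
  ΘAt odd []          = []
  ΘAt odd (r1 ∷ a)    = (if odd then t1' else t1) ∷ ΘAt (not odd) a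
  ΘAt odd (r1⁻ ∷ a)   = (if odd then t1 else t1') ∷ ΘAt (not odd) a
  ΘAt odd (r j ∷ a)   = t j ∷ ΘAt (not odd) a

  Θ : List RL → List SL
  Θ = ΘAt true

  -- the bijection R∪R⁻¹ → S' of part (iii); the Bool says whether ℓ(w) is even
  φ : Bool → RL → SL
  φ true  r1    = t1'
  φ true  r1⁻   = t1
  φ false r1    = t1
  φ false r1⁻   = t1'
  φ _     (r j) = t j

  DesR : Word → RL → Set
  DesR w x = ∃ λ k → ∃ λ k' → LenR w k × LenR (w ++ expR x) k' × k' < k

  DesS : Word → SL → Set
  DesS u s = ∃ λ k → ∃ λ k' → LenS u k × LenS (u ++ expS s) k' × k' < k

  IsPal : Word → Set
  IsPal p = ∃ λ a → isEven (length a) ≡ false × reverse a ≡ a × expRs a ≈ p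

  infix 4 _≤RW_ _≤RS_ _≤W'_ _≤B_
  data _≤RW_ : Word → Word → Set where
    rw-refl : ∀ {w v} → w ≈ v → w ≤RW v
    rw-step : ∀ {w v u} → w ≤RW v → (x : RL) (k : ℕ) →
              LenR v k → LenR (v ++ expR x) (suc k) → (v ++ expR x) ≈ u → w ≤RW u

  data _≤RS_ : Word → Word → Set where
    rs-refl : ∀ {w v} → w ≈ v → w ≤RS v
    rs-step : ∀ {w v u} → w ≤RS v → (p : Word) → IsPal p → (k k' : ℕ) →
              LenR v k → LenR (v ++ p) k' → k < k' → (v ++ p) ≈ u → w ≤RS u

  data _≤W'_ : Word → Word → Set where
    w'-refl : ∀ {w v} → w ≈ v → w ≤W' v
    w'-step : ∀ {w v u} → w ≤W' v → (s : SL) (k : ℕ) →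
              LenS v k → LenS (v ++ expS s) (suc k) → (v ++ expS s) ≈ u → w ≤W' u

  IsRefl' : Word → Set
  IsRefl' q = ∃ λ x → ∃ λ s → (expSs x ++ (expS s ++ reverse (expSs x))) ≈ q

  data _≤B_ : Word → Word → Set where
    b-refl : ∀ {w v} → w ≈ v → w ≤B v
    b-step : ∀ {w v u} → w ≤B v → (q : Word) → IsRefl' q → (k k' : ℕ) →
             LenS v k → LenS (v ++ q) k' → k < k' → (v ++ q) ≈ u → w ≤B u

{-# OPTIONS --safe #-}
-- Write w ∈ W⁺ as a word in the letters r = s₀ s of R ∪ R⁻¹ and push every s₀ to the right.
-- Since s₀ commutes with s₂, …, s_n and t₁' = s₀ s₁ s₀, a prefix with an even number of s₀'s
-- followed by r equals the prefix, one letter of S' and a leftover s₀; a prefix with a leftover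
-- s₀ followed by r equals the prefix and one letter of S'. Which letter r₁^{±1} becomes depends
-- only on this parity, that is on its position, so θ of the element spelled by a word is the
-- element spelled by its Θ-image. As Θ is a length-preserving bijection of words and θ is a
-- bijection W⁺ → W', lengths, reduced words, descents and the covers of the weak orders
-- correspond. The parities of the length and of the number of s₀'s are invariants of W, because
-- each relator (s_i s_j)^{m_ij} has even length and, s₀ being an even leaf, an even number of
-- s₀'s; they make θ well defined and injective on W⁺. Reversing a word of odd length preserves
-- the parity of positions, so Θ maps odd palindromes to odd palindromes, and the odd palindromes
-- x s x⁻¹ over S' are exactly the reflections of W', which gives the Bruhat order.

module Submission where

open import Defs
open import Data.Nat using (ℕ; zero; suc; _+_; _≤_)
open import Data.Fin using (zero; suc)
open import Data.Nat.Properties using (+-suc; suc-injective)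
open import Data.List using (List; []; _∷_; _++_; [_]; length; reverse; concatMap)
open import Data.List.Properties
  using (++-assoc; ++-identityʳ; length-++; length-++-comm; length-reverse; reverse-++; unfold-reverse; reverse-involutive; ∷-injectiveʳ; concatMap-++)
open import Data.Bool using (Bool; true; false; not; if_then_else_; _xor_; _∧_)
open import Data.Bool.Properties using (not-involutive; xor-assoc; ∧-zeroʳ)
open import Data.Product using (_×_; _,_; ∃; ∃₂)
open import Relation.Binary.PropositionalEquality
  using (_≡_; refl; sym; trans; cong; cong₂; subst; subst₂; module ≡-Reasoning)
open import Relation.Binary.Bundles using (Setoid)
open import Level using (0ℓ)
open import Function.Bundles using (_⇔_; mk⇔)

isEven-half : ∀ k → ∃ λ h → k ≡ (if isEven k then h + h else h + suc h)
isEven-half zero = zero , refl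
isEven-half (suc k) with isEven k | isEven-half k
... | true  | h , k≡h+h   = h , trans (cong suc k≡h+h) (sym (+-suc h h))
... | false | h , k≡h+1+h = suc h , cong suc k≡h+1+h

isEven-+-suc-self : ∀ h → isEven (h + suc h) ≡ false
isEven-+-suc-self zero = refl
isEven-+-suc-self (suc h)
  rewrite +-suc h (suc h) | not-involutive (isEven (h + suc h)) = isEven-+-suc-self h

isEven-+ : ∀ a b → isEven (a + b) ≡ (if isEven a then isEven b else not (isEven b))
isEven-+ zero    b = refl
isEven-+ (suc a) b with isEven a | isEven-+ a b
... | true  | e = cong not e
... | false | e = trans (cong not e) (not-involutive (isEven b))

flips : ℕ → Bool → Bool
flips zero    o = o
flips (suc k) o = flips k (not o)

flips-not : ∀ k o → flips k (not o) ≡ not (flips k o)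
flips-not zero    o = refl
flips-not (suc k) o = flips-not k (not o)

flips-isEven : ∀ k o → flips k o ≡ (if isEven k then o else not o)
flips-isEven zero    o = refl
flips-isEven (suc k) o with isEven k | flips-isEven k (not o)
... | true  | e = e
... | false | e = trans e (not-involutive o)

module _ {A : Set} where

  OddPalindrome : List A → Set
  OddPalindrome c = isEven (length c) ≡ false × reverse c ≡ c

  ++-cancelˡ-length : ∀ (p q : List A) {u v} → length p ≡ length q → p ++ u ≡ q ++ v → u ≡ v
  ++-cancelˡ-length []      []      _   e = e
  ++-cancelˡ-length (_ ∷ p) (_ ∷ q) |p| e = ++-cancelˡ-length p q (suc-injective |p|) (∷-injectiveʳ e)

  split-middle : ∀ h {j} (c : List A) → length c ≡ h + suc j →
             ∃₂ λ x s → ∃ λ y → c ≡ x ++ s ∷ y × length x ≡ h × length y ≡ j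
  split-middle zero    (s ∷ y) |c| = [] , s , y , refl , refl , suc-injective |c|
  split-middle (suc h) (a ∷ c) |c| with split-middle h c (suc-injective |c|)
  ... | x , s , y , c≡ , |x| , |y| = a ∷ x , s , y , cong (a ∷_) c≡ , cong suc |x| , |y|

  reverse-concatMap : ∀ {B : Set} (f : B → List A) → (∀ x → reverse (f x) ≡ f x) →
                      ∀ xs → reverse (concatMap f xs) ≡ concatMap f (reverse xs)
  reverse-concatMap f f-palindromic []       = refl
  reverse-concatMap f f-palindromic (x ∷ xs) = begin
    reverse (f x ++ concatMap f xs)               ≡⟨ reverse-++ (f x) (concatMap f xs) ⟩
    reverse (concatMap f xs) ++ reverse (f x)     ≡⟨ cong₂ _++_ (reverse-concatMap f f-palindromic xs)
                                                                (f-palindromic x) ⟩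
    concatMap f (reverse xs) ++ f x               ≡⟨ cong (concatMap f (reverse xs) ++_) (++-identityʳ (f x)) ⟨
    concatMap f (reverse xs) ++ concatMap f [ x ] ≡⟨ concatMap-++ f (reverse xs) [ x ] ⟨
    concatMap f (reverse xs ++ [ x ])             ≡⟨ cong (concatMap f) (unfold-reverse x xs) ⟨
    concatMap f (reverse (x ∷ xs))                ∎
    where open ≡-Reasoning

  reverse-++-∷ : ∀ (x : List A) s y → reverse (x ++ s ∷ y) ≡ reverse y ++ s ∷ reverse x
  reverse-++-∷ x s y = begin
    reverse (x ++ s ∷ y)            ≡⟨ reverse-++ x (s ∷ y) ⟩
    reverse (s ∷ y) ++ reverse x    ≡⟨ cong (_++ reverse x) (unfold-reverse s y) ⟩
    (reverse y ++ [ s ]) ++ reverse x ≡⟨ ++-assoc (reverse y) [ s ] (reverse x) ⟩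
    reverse y ++ s ∷ reverse x      ∎
    where open ≡-Reasoning

  mirror-oddPalindrome : ∀ (x : List A) s → OddPalindrome (x ++ s ∷ reverse x)
  mirror-oddPalindrome x s = odd , rev
    where
    odd : isEven (length (x ++ s ∷ reverse x)) ≡ false
    odd rewrite length-++ x {s ∷ reverse x} | length-reverse x = isEven-+-suc-self (length x)
    rev : reverse (x ++ s ∷ reverse x) ≡ x ++ s ∷ reverse x
    rev = trans (reverse-++-∷ x s (reverse x)) (cong (_++ s ∷ reverse x) (reverse-involutive x))

  oddPalindrome-split : ∀ {c : List A} → OddPalindrome c → ∃₂ λ x s → c ≡ x ++ s ∷ reverse x
  oddPalindrome-split {c} (odd , rev) with isEven-half (length c)
  ... | h , |c|≡ with split-middle h c (subst (λ b → length c ≡ (if b then h + h else h + suc h)) odd |c|≡)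
  ... | x , s , y , refl , |x| , |y| = x , s , cong (λ z → x ++ s ∷ z) (sym reverse-x≡y)
    where
    reverse-x≡y : reverse x ≡ y
    reverse-x≡y = ∷-injectiveʳ (++-cancelˡ-length (reverse y) x
      (trans (length-reverse y) (trans |y| (sym |x|)))
      (trans (sym (reverse-++-∷ x s y)) rev))

module WordCongruence {n : ℕ} (m : CoxMatrix n) where
  open Cox m

  ≈-setoid : Setoid 0ℓ 0ℓ
  ≈-setoid = record { Carrier = Word ; _≈_ = _≈_
                    ; isEquivalence = record { refl = ≈refl ; sym = ≈sym ; trans = ≈trans } }

  ≡⇒≈ : ∀ {x y} → x ≡ y → x ≈ y
  ≡⇒≈ refl = ≈refl

  ++-congˡ : ∀ z {x y} → x ≈ y → z ++ x ≈ z ++ y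
  ++-congˡ z ≈refl                = ≈refl
  ++-congˡ z (≈sym p)             = ≈sym (++-congˡ z p)
  ++-congˡ z (≈trans p q)         = ≈trans (++-congˡ z p) (++-congˡ z q)
  ++-congˡ z (≈rel u v i j k mij) =
    subst₂ _≈_ (++-assoc z u _) (++-assoc z u v) (≈rel (z ++ u) v i j k mij)

  ++-congʳ : ∀ z {x y} → x ≈ y → x ++ z ≈ y ++ z
  ++-congʳ z ≈refl                = ≈refl
  ++-congʳ z (≈sym p)             = ≈sym (++-congʳ z p)
  ++-congʳ z (≈trans p q)         = ≈trans (++-congʳ z p) (++-congʳ z q)
  ++-congʳ z (≈rel u v i j k mij) = subst₂ _≈_
    (sym (trans (++-assoc u _ z) (cong (u ++_) (++-assoc (alt i j k) v z))))
    (sym (++-assoc u v z))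
    (≈rel u (v ++ z) i j k mij)

  parity : (Gen → Bool) → Word → Bool
  parity f []      = false
  parity f (g ∷ w) = f g xor parity f w

  parity-++ : ∀ f u v → parity f (u ++ v) ≡ parity f u xor parity f v
  parity-++ f []      v = refl
  parity-++ f (g ∷ u) v = trans (cong (f g xor_) (parity-++ f u v)) (sym (xor-assoc (f g) _ _))

  parity-alt : ∀ f i j k → parity f (alt i j k) ≡ (f i xor f j) ∧ not (isEven k)
  parity-alt f i j zero    = sym (∧-zeroʳ (f i xor f j))
  parity-alt f i j (suc k) = begin
    f i xor (f j xor parity f (alt i j k))  ≡⟨ xor-assoc (f i) (f j) _ ⟨
    c xor parity f (alt i j k)              ≡⟨ cong (c xor_) (parity-alt f i j k) ⟩
    c xor (c ∧ not (isEven k))              ≡⟨ xor-∧-not c ⟩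
    c ∧ not (not (isEven k))                ∎
    where
    open ≡-Reasoning
    c = f i xor f j
    xor-∧-not : ∀ c {b} → c xor (c ∧ b) ≡ c ∧ not b
    xor-∧-not true  = refl
    xor-∧-not false = refl

  RelatorsEven : (Gen → Bool) → Set
  RelatorsEven f = ∀ i j k → m i j ≡ fin k → parity f (alt i j k) ≡ false

  parity-resp-≈ : ∀ f → RelatorsEven f → ∀ {x y} → x ≈ y → parity f x ≡ parity f y
  parity-resp-≈ f even ≈refl                = refl
  parity-resp-≈ f even (≈sym p)             = sym (parity-resp-≈ f even p)
  parity-resp-≈ f even (≈trans p q)         = trans (parity-resp-≈ f even p) (parity-resp-≈ f even q)
  parity-resp-≈ f even (≈rel u v i j k mij) = begin
    parity f (u ++ (alt i j k ++ v))                ≡⟨ parity-++ f u _ ⟩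
    parity f u xor parity f (alt i j k ++ v)        ≡⟨ cong (parity f u xor_) (parity-++ f (alt i j k) v) ⟩
    parity f u xor (parity f (alt i j k) xor parity f v)
      ≡⟨ cong (λ b → parity f u xor (b xor parity f v)) (even i j k mij) ⟩
    parity f u xor parity f v                       ≡⟨ parity-++ f u v ⟨
    parity f (u ++ v)                               ∎
    where open ≡-Reasoning

  isEven-length : ∀ w → isEven (length w) ≡ not (parity (λ _ → true) w)
  isEven-length []      = refl
  isEven-length (_ ∷ w) = cong not (isEven-length w)

  isEven-length-resp-≈ : ∀ {x y} → x ≈ y → isEven (length x) ≡ isEven (length y)
  isEven-length-resp-≈ {x} {y} x≈y = begin
    isEven (length x)               ≡⟨ isEven-length x ⟩
    not (parity (λ _ → true) x)     ≡⟨ cong not (parity-resp-≈ _ (λ i j k _ → parity-alt _ i j k) x≈y) ⟩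
    not (parity (λ _ → true) y)     ≡⟨ isEven-length y ⟨
    isEven (length y)               ∎
    where open ≡-Reasoning

module Translation {n : ℕ} (m : CoxMatrix n) where
  open Cox m

  φ⁻¹ : Bool → SL → RL
  φ⁻¹ true  t1    = r1⁻
  φ⁻¹ true  t1'   = r1
  φ⁻¹ false t1    = r1
  φ⁻¹ false t1'   = r1⁻
  φ⁻¹ _     (t j) = r j

  φ-φ⁻¹ : ∀ o s → φ o (φ⁻¹ o s) ≡ s
  φ-φ⁻¹ true  t1    = refl
  φ-φ⁻¹ true  t1'   = refl
  φ-φ⁻¹ true  (t j) = refl
  φ-φ⁻¹ false t1    = refl
  φ-φ⁻¹ false t1'   = refl
  φ-φ⁻¹ false (t j) = refl

  φ⁻¹-φ : ∀ o x → φ⁻¹ o (φ o x) ≡ x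
  φ⁻¹-φ true  r1    = refl
  φ⁻¹-φ true  r1⁻   = refl
  φ⁻¹-φ true  (r j) = refl
  φ⁻¹-φ false r1    = refl
  φ⁻¹-φ false r1⁻   = refl
  φ⁻¹-φ false (r j) = refl

  ΘAt-∷ : ∀ o x a → ΘAt o (x ∷ a) ≡ φ o x ∷ ΘAt (not o) a
  ΘAt-∷ true  r1    a = refl
  ΘAt-∷ true  r1⁻   a = refl
  ΘAt-∷ true  (r j) a = refl
  ΘAt-∷ false r1    a = refl
  ΘAt-∷ false r1⁻   a = refl
  ΘAt-∷ false (r j) a = refl

  Θ⁻¹At : Bool → List SL → List RL
  Θ⁻¹At o []      = []
  Θ⁻¹At o (s ∷ b) = φ⁻¹ o s ∷ Θ⁻¹At (not o) b

  Θ⁻¹ : List SL → List RL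
  Θ⁻¹ = Θ⁻¹At true

  ΘAt-Θ⁻¹At : ∀ o b → ΘAt o (Θ⁻¹At o b) ≡ b
  ΘAt-Θ⁻¹At o []      = refl
  ΘAt-Θ⁻¹At o (s ∷ b) =
    trans (ΘAt-∷ o (φ⁻¹ o s) _) (cong₂ _∷_ (φ-φ⁻¹ o s) (ΘAt-Θ⁻¹At (not o) b))

  Θ⁻¹At-ΘAt : ∀ o a → Θ⁻¹At o (ΘAt o a) ≡ a
  Θ⁻¹At-ΘAt o []      = refl
  Θ⁻¹At-ΘAt o (x ∷ a) rewrite ΘAt-∷ o x a = cong₂ _∷_ (φ⁻¹-φ o x) (Θ⁻¹At-ΘAt (not o) a)

  ΘAt-injective : ∀ o {a a′} → ΘAt o a ≡ ΘAt o a′ → a ≡ a′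
  ΘAt-injective o {a} {a′} e = begin
    a                    ≡⟨ Θ⁻¹At-ΘAt o a ⟨
    Θ⁻¹At o (ΘAt o a)    ≡⟨ cong (Θ⁻¹At o) e ⟩
    Θ⁻¹At o (ΘAt o a′)   ≡⟨ Θ⁻¹At-ΘAt o a′ ⟩
    a′                   ∎
    where open ≡-Reasoning

  length-ΘAt : ∀ o a → length (ΘAt o a) ≡ length a
  length-ΘAt o []      = refl
  length-ΘAt o (x ∷ a) rewrite ΘAt-∷ o x a = cong suc (length-ΘAt (not o) a)

  length-Θ⁻¹At : ∀ o b → length (Θ⁻¹At o b) ≡ length b
  length-Θ⁻¹At o []      = refl
  length-Θ⁻¹At o (s ∷ b) = cong suc (length-Θ⁻¹At (not o) b)

  ΘAt-++ : ∀ o a a′ → ΘAt o (a ++ a′) ≡ ΘAt o a ++ ΘAt (flips (length a) o) a′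
  ΘAt-++ o []      a′ = refl
  ΘAt-++ o (x ∷ a) a′ rewrite ΘAt-∷ o x (a ++ a′) | ΘAt-∷ o x a =
    cong (φ o x ∷_) (ΘAt-++ (not o) a a′)

  reverse-ΘAt : ∀ o a → reverse (ΘAt (not (flips (length a) o)) a) ≡ ΘAt o (reverse a)
  reverse-ΘAt o []      = refl
  reverse-ΘAt o (x ∷ a) = begin
    reverse (ΘAt (not (flips (length a) (not o))) (x ∷ a))
      ≡⟨ cong (λ o′ → reverse (ΘAt o′ (x ∷ a))) last≡ ⟩
    reverse (ΘAt p (x ∷ a))                     ≡⟨ cong reverse (ΘAt-∷ p x a) ⟩
    reverse (φ p x ∷ ΘAt (not p) a)             ≡⟨ unfold-reverse (φ p x) (ΘAt (not p) a) ⟩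
    reverse (ΘAt (not p) a) ++ [ φ p x ]        ≡⟨ cong (_++ [ φ p x ]) (reverse-ΘAt o a) ⟩
    ΘAt o (reverse a) ++ [ φ p x ]              ≡⟨ cong (ΘAt o (reverse a) ++_) (ΘAt-∷ p x []) ⟨
    ΘAt o (reverse a) ++ ΘAt p [ x ]            ≡⟨ cong (λ k → ΘAt o (reverse a) ++ ΘAt (flips k o) [ x ])
                                                        (length-reverse a) ⟨
    ΘAt o (reverse a) ++ ΘAt (flips (length (reverse a)) o) [ x ]
                                                ≡⟨ ΘAt-++ o (reverse a) [ x ] ⟨
    ΘAt o (reverse a ++ [ x ])                  ≡⟨ cong (ΘAt o) (unfold-reverse x a) ⟨
    ΘAt o (reverse (x ∷ a))                     ∎
    where
    open ≡-Reasoning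
    p = flips (length a) o
    last≡ : not (flips (length a) (not o)) ≡ p
    last≡ = trans (cong not (flips-not (length a) o)) (not-involutive p)

  reverse-ΘAt-odd : ∀ o a → isEven (length a) ≡ false → reverse (ΘAt o a) ≡ ΘAt o (reverse a)
  reverse-ΘAt-odd o a odd = subst (λ o′ → reverse (ΘAt o′ a) ≡ ΘAt o (reverse a)) first≡o (reverse-ΘAt o a)
    where
    first≡o : not (flips (length a) o) ≡ o
    first≡o = trans (cong not (trans (flips-isEven (length a) o) (cong (λ b → if b then o else not o) odd)))
                    (not-involutive o)

  ΘAt-oddPalindrome : ∀ o {a} → OddPalindrome a → OddPalindrome (ΘAt o a)
  ΘAt-oddPalindrome o {a} (odd , rev) =
    trans (cong isEven (length-ΘAt o a)) odd ,
    trans (reverse-ΘAt-odd o a odd) (cong (ΘAt o) rev)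

  Θ⁻¹At-oddPalindrome : ∀ o {c} → OddPalindrome c → OddPalindrome (Θ⁻¹At o c)
  Θ⁻¹At-oddPalindrome o {c} (odd , rev) = odd′ , ΘAt-injective o (begin
    ΘAt o (reverse a)   ≡⟨ reverse-ΘAt-odd o a odd′ ⟨
    reverse (ΘAt o a)   ≡⟨ cong reverse (ΘAt-Θ⁻¹At o c) ⟩
    reverse c           ≡⟨ rev ⟩
    c                   ≡⟨ ΘAt-Θ⁻¹At o c ⟨
    ΘAt o a             ∎)
    where
    open ≡-Reasoning
    a = Θ⁻¹At o c
    odd′ : isEven (length a) ≡ false
    odd′ = trans (cong isEven (length-Θ⁻¹At o c)) odd

module EvenLeafTranslation {n : ℕ} {m : CoxMatrix n} (cm : IsCoxeterMatrix m) (el : EvenLeaf m) where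
  open Cox m
  open IsCoxeterMatrix cm
  open EvenLeaf el
  open WordCongruence m
  open Translation m
  open import Relation.Binary.Reasoning.Setoid ≈-setoid

  pattern s₀ = zero
  pattern s₁ = suc zero

  cancel : ∀ u v g → u ++ g ∷ g ∷ v ≈ u ++ v
  cancel u v g = ≈rel u v g g 1 (diag g)

  s₀-comm : ∀ j → s₀ ∷ suc (suc j) ∷ [] ≈ suc (suc j) ∷ s₀ ∷ []
  s₀-comm j = begin
    s₀ ∷ g ∷ []                    ≈⟨ cancel [] (s₀ ∷ g ∷ []) g ⟨
    g ∷ g ∷ s₀ ∷ g ∷ []            ≈⟨ cancel (g ∷ []) (g ∷ s₀ ∷ g ∷ []) s₀ ⟨
    g ∷ s₀ ∷ s₀ ∷ g ∷ s₀ ∷ g ∷ []  ≈⟨ ≈rel (g ∷ s₀ ∷ []) [] s₀ g 2 (comm0j j) ⟩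
    g ∷ s₀ ∷ []                    ∎
    where g = suc (suc j)

  isS₀ : Gen → Bool
  isS₀ s₀      = true
  isS₀ (suc _) = false

  m₀-even : ∀ g {k} → m s₀ (suc g) ≡ fin k → isEven k ≡ true
  m₀-even zero    m₀₁≡k = subst EvenOrInf m₀₁≡k even01
  m₀-even (suc j) m₀ⱼ≡k = subst EvenOrInf (trans (sym (comm0j j)) m₀ⱼ≡k) refl

  isS₀-relatorsEven : RelatorsEven isS₀
  isS₀-relatorsEven i j k mij rewrite parity-alt isS₀ i j k with i | j
  ... | s₀    | s₀    = refl
  ... | s₀    | suc g = cong not (m₀-even g mij)
  ... | suc g | s₀    = cong not (m₀-even g (trans (symm s₀ (suc g)) mij))
  ... | suc _ | suc _ = refl

  even₀ : Word → Bool
  even₀ w = isEven (count0 w)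

  even₀≡not-parity : ∀ w → even₀ w ≡ not (parity isS₀ w)
  even₀≡not-parity []          = refl
  even₀≡not-parity (s₀ ∷ w)    = cong not (even₀≡not-parity w)
  even₀≡not-parity (suc _ ∷ w) = even₀≡not-parity w

  even₀-resp-≈ : ∀ {x y} → x ≈ y → even₀ x ≡ even₀ y
  even₀-resp-≈ {x} {y} x≈y = trans (even₀≡not-parity x)
    (trans (cong not (parity-resp-≈ isS₀ isS₀-relatorsEven x≈y)) (sym (even₀≡not-parity y)))

  even₀-++-single : ∀ v {y} → count0 y ≡ 1 → even₀ (v ++ y) ≡ not (even₀ v)
  even₀-++-single []          |y|₀ = cong isEven |y|₀
  even₀-++-single (s₀ ∷ v)    |y|₀ = cong not (even₀-++-single v |y|₀)
  even₀-++-single (suc _ ∷ v) |y|₀ = even₀-++-single v |y|₀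

  count0-expR : ∀ x → count0 (expR x) ≡ 1
  count0-expR r1    = refl
  count0-expR r1⁻   = refl
  count0-expR (r j) = refl

  even₀-++-expR : ∀ v x → even₀ (v ++ expR x) ≡ not (even₀ v)
  even₀-++-expR v x = even₀-++-single v (count0-expR x)

  count0-expRs : ∀ a → count0 (expRs a) ≡ length a
  count0-expRs []          = refl
  count0-expRs (r1 ∷ a)    = cong suc (count0-expRs a)
  count0-expRs (r1⁻ ∷ a)   = cong suc (count0-expRs a)
  count0-expRs (r j ∷ a)   = cong suc (count0-expRs a)

  InW⁺-resp-≈ : ∀ {x y} → x ≈ y → InW⁺ x → InW⁺ y
  InW⁺-resp-≈ x≈y = trans (sym (isEven-length-resp-≈ x≈y))

  InW⁺-++ : ∀ {u v} → InW⁺ u → InW⁺ v → InW⁺ (u ++ v)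
  InW⁺-++ {u} {v} u∈W⁺ v∈W⁺ rewrite length-++ u {v} | isEven-+ (length u) (length v) | u∈W⁺ = v∈W⁺

  InW⁺-expR : ∀ x → InW⁺ (expR x)
  InW⁺-expR r1    = refl
  InW⁺-expR r1⁻   = refl
  InW⁺-expR (r j) = refl

  InW⁺-expRs : ∀ a → InW⁺ (expRs a)
  InW⁺-expRs []      = refl
  InW⁺-expRs (x ∷ a) = InW⁺-++ {expR x} (InW⁺-expR x) (InW⁺-expRs a)

  s₀Unless : Bool → Word
  s₀Unless true  = []
  s₀Unless false = [ s₀ ]

  θ≡ : ∀ w → θ w ≡ w ++ s₀Unless (even₀ w)
  θ≡ w with even₀ w
  ... | true  = sym (++-identityʳ w)
  ... | false = refl

  ++-s₀Unless-twice : ∀ o u → (u ++ s₀Unless o) ++ s₀Unless o ≈ u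
  ++-s₀Unless-twice true  u = ≡⇒≈ (trans (++-identityʳ _) (++-identityʳ u))
  ++-s₀Unless-twice false u = begin
    (u ++ [ s₀ ]) ++ [ s₀ ]  ≡⟨ ++-assoc u [ s₀ ] [ s₀ ] ⟩
    u ++ s₀ ∷ s₀ ∷ []        ≈⟨ cancel u [] s₀ ⟩
    u ++ []                  ≡⟨ ++-identityʳ u ⟩
    u                        ∎

  isEven-length-θ : ∀ {w} → InW⁺ w → isEven (length (θ w)) ≡ even₀ w
  isEven-length-θ {w} w∈W⁺ = trans (cong (λ u → isEven (length u)) (θ≡ w)) (isEven-length-++-s₀Unless (even₀ w))
    where
    isEven-length-++-s₀Unless : ∀ o → isEven (length (w ++ s₀Unless o)) ≡ o
    isEven-length-++-s₀Unless true  = trans (cong (λ u → isEven (length u)) (++-identityʳ w)) w∈W⁺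
    isEven-length-++-s₀Unless false = trans (cong isEven (length-++-comm w [ s₀ ])) (cong not w∈W⁺)

  θ-cong : ∀ {x y} → x ≈ y → θ x ≈ θ y
  θ-cong {x} {y} x≈y = begin
    θ x                        ≡⟨ θ≡ x ⟩
    x ++ s₀Unless (even₀ x)    ≈⟨ ++-congʳ _ x≈y ⟩
    y ++ s₀Unless (even₀ x)    ≡⟨ cong (λ o → y ++ s₀Unless o) (even₀-resp-≈ x≈y) ⟩
    y ++ s₀Unless (even₀ y)    ≡⟨ θ≡ y ⟨
    θ y                        ∎

  θ-injective : ∀ {w v} → InW⁺ w → InW⁺ v → θ w ≈ θ v → w ≈ v
  θ-injective {w} {v} w∈W⁺ v∈W⁺ θw≈θv = begin
    w                                       ≈⟨ ++-s₀Unless-twice o w ⟨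
    (w ++ s₀Unless o) ++ s₀Unless o         ≡⟨ cong (_++ s₀Unless o) (θ≡ w) ⟨
    θ w ++ s₀Unless o                       ≈⟨ ++-congʳ _ θw≈θv ⟩
    θ v ++ s₀Unless o                       ≡⟨ cong (_++ s₀Unless o) (θ≡ v) ⟩
    (v ++ s₀Unless (even₀ v)) ++ s₀Unless o ≡⟨ cong (λ o′ → (v ++ s₀Unless o′) ++ s₀Unless o) same-parity ⟨
    (v ++ s₀Unless o) ++ s₀Unless o         ≈⟨ ++-s₀Unless-twice o v ⟩
    v                                       ∎
    where
    o = even₀ w
    same-parity : even₀ w ≡ even₀ v
    same-parity = trans (sym (isEven-length-θ {w} w∈W⁺))
                        (trans (isEven-length-resp-≈ θw≈θv) (isEven-length-θ {v} v∈W⁺))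

  θ-InW' : ∀ w → InW' (θ w)
  θ-InW' w = trans (cong even₀ (θ≡ w)) (even₀-++-s₀Unless (even₀ w) refl)
    where
    even₀-++-s₀Unless : ∀ o → even₀ w ≡ o → even₀ (w ++ s₀Unless o) ≡ true
    even₀-++-s₀Unless true  e = trans (cong even₀ (++-identityʳ w)) e
    even₀-++-s₀Unless false e = trans (even₀-++-single w refl) (cong not e)

  θ-surjective : ∀ {u} → InW' u → ∃ λ w → InW⁺ w × θ w ≈ u
  θ-surjective {u} u∈W' with isEven (length u) in |u|
  ... | true  = u , |u| , ≡⇒≈ (trans (θ≡ u) (trans (cong (λ o → u ++ s₀Unless o) u∈W') (++-identityʳ u)))
  ... | false = u ++ [ s₀ ] , trans (cong isEven (length-++-comm u [ s₀ ])) (cong not |u|) , (begin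
    θ (u ++ [ s₀ ])                                ≡⟨ θ≡ (u ++ [ s₀ ]) ⟩
    (u ++ [ s₀ ]) ++ s₀Unless (even₀ (u ++ [ s₀ ])) ≡⟨ cong (λ o → (u ++ [ s₀ ]) ++ s₀Unless o)
                                                           (trans (even₀-++-single u refl) (cong not u∈W')) ⟩
    (u ++ [ s₀ ]) ++ [ s₀ ]                        ≈⟨ ++-s₀Unless-twice false u ⟩
    u                                              ∎)

  s₀Unless-expS-φ : ∀ o x → s₀Unless o ++ expS (φ o x) ≈ expR x ++ s₀Unless (not o)
  s₀Unless-expS-φ true  r1    = ≈refl
  s₀Unless-expS-φ true  r1⁻   = ≈sym (cancel [ s₁ ] [] s₀)
  s₀Unless-expS-φ true  (r j) = ≈sym (≈trans (++-congˡ [ s₀ ] (≈sym (s₀-comm j))) (cancel [] _ s₀))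
  s₀Unless-expS-φ false r1    = ≈refl
  s₀Unless-expS-φ false r1⁻   = cancel [] _ s₀
  s₀Unless-expS-φ false (r j) = ≈refl

  θ-++-expR : ∀ v x → θ (v ++ expR x) ≈ θ v ++ expS (φ (even₀ v) x)
  θ-++-expR v x = begin
    θ (v ++ expR x)                                   ≡⟨ θ≡ (v ++ expR x) ⟩
    (v ++ expR x) ++ s₀Unless (even₀ (v ++ expR x))   ≡⟨ cong (λ o′ → (v ++ expR x) ++ s₀Unless o′)
                                                              (even₀-++-expR v x) ⟩
    (v ++ expR x) ++ s₀Unless (not o)                 ≡⟨ ++-assoc v (expR x) _ ⟩
    v ++ (expR x ++ s₀Unless (not o))                 ≈⟨ ++-congˡ v (s₀Unless-expS-φ o x) ⟨
    v ++ (s₀Unless o ++ expS (φ o x))                 ≡⟨ ++-assoc v (s₀Unless o) _ ⟨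
    (v ++ s₀Unless o) ++ expS (φ o x)                 ≡⟨ cong (_++ expS (φ o x)) (θ≡ v) ⟨
    θ v ++ expS (φ o x)                               ∎
    where o = even₀ v

  -- The flag of ΘAt ("the next position is odd") is the parity even₀ of the prefix, because
  -- every letter of R ∪ R⁻¹ contains exactly one s₀.
  θ-++-expRs : ∀ v a → θ (v ++ expRs a) ≈ θ v ++ expSs (ΘAt (even₀ v) a)
  θ-++-expRs v []      = ≡⇒≈ (trans (cong θ (++-identityʳ v)) (sym (++-identityʳ (θ v))))
  θ-++-expRs v (x ∷ a) = begin
    θ (v ++ (expR x ++ expRs a))                            ≡⟨ cong θ (++-assoc v (expR x) _) ⟨
    θ ((v ++ expR x) ++ expRs a)                            ≈⟨ θ-++-expRs (v ++ expR x) a ⟩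
    θ (v ++ expR x) ++ expSs (ΘAt (even₀ (v ++ expR x)) a)  ≡⟨ cong (λ o′ → θ (v ++ expR x) ++ expSs (ΘAt o′ a))
                                                                    (even₀-++-expR v x) ⟩
    θ (v ++ expR x) ++ expSs (ΘAt (not o) a)                ≈⟨ ++-congʳ _ (θ-++-expR v x) ⟩
    (θ v ++ expS (φ o x)) ++ expSs (ΘAt (not o) a)          ≡⟨ ++-assoc (θ v) (expS (φ o x)) _ ⟩
    θ v ++ expSs (φ o x ∷ ΘAt (not o) a)                    ≡⟨ cong (λ c → θ v ++ expSs c) (ΘAt-∷ o x a) ⟨
    θ v ++ expSs (ΘAt o (x ∷ a))                            ∎
    where o = even₀ v

  θ-expRs : ∀ a → θ (expRs a) ≈ expSs (Θ a)
  θ-expRs = θ-++-expRs []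

  θ-expRs-Θ⁻¹ : ∀ b → θ (expRs (Θ⁻¹ b)) ≈ expSs b
  θ-expRs-Θ⁻¹ b = ≈trans (θ-expRs (Θ⁻¹ b)) (≡⇒≈ (cong expSs (ΘAt-Θ⁻¹At true b)))

  expRs≈⇒expSs≈ : ∀ a {w} → expRs a ≈ w → expSs (Θ a) ≈ θ w
  expRs≈⇒expSs≈ a a≈w = ≈trans (≈sym (θ-expRs a)) (θ-cong a≈w)

  expSs≈⇒expRs≈ : ∀ b {w} → InW⁺ w → expSs b ≈ θ w → expRs (Θ⁻¹ b) ≈ w
  expSs≈⇒expRs≈ b w∈W⁺ b≈θw = θ-injective (InW⁺-expRs (Θ⁻¹ b)) w∈W⁺ (≈trans (θ-expRs-Θ⁻¹ b) b≈θw)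

  LenR⇒InW⁺ : ∀ {v k} → LenR v k → InW⁺ v
  LenR⇒InW⁺ ((a , _ , a≈v) , _) = InW⁺-resp-≈ a≈v (InW⁺-expRs a)

  LenR-parity : ∀ {w k} → LenR w k → isEven k ≡ even₀ w
  LenR-parity ((a , |a|≡k , a≈w) , _) =
    trans (cong isEven (trans (sym |a|≡k) (sym (count0-expRs a)))) (even₀-resp-≈ a≈w)

  LenR⇒LenS : ∀ {v u k} → LenR v k → θ v ≈ u → LenS u k
  LenR⇒LenS L@((a , |a|≡k , a≈v) , minimal) θv≈u =
    (Θ a , trans (length-ΘAt true a) |a|≡k , ≈trans (expRs≈⇒expSs≈ a a≈v) θv≈u) ,
    λ b b≈u → subst (_ ≤_) (length-Θ⁻¹At true b)
      (minimal (Θ⁻¹ b) (expSs≈⇒expRs≈ b (LenR⇒InW⁺ L) (≈trans b≈u (≈sym θv≈u))))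

  LenS⇒LenR : ∀ v {u k} → InW⁺ v → LenS u k → θ v ≈ u → LenR v k
  LenS⇒LenR v v∈W⁺ ((b , |b|≡k , b≈u) , minimal) θv≈u =
    (Θ⁻¹ b , trans (length-Θ⁻¹At true b) |b|≡k , expSs≈⇒expRs≈ b v∈W⁺ (≈trans b≈u (≈sym θv≈u))) ,
    λ a a≈v → subst (_ ≤_) (length-ΘAt true a) (minimal (Θ a) (≈trans (expRs≈⇒expSs≈ a a≈v) θv≈u))

  LenR⇔LenS : ∀ {w} → InW⁺ w → ∀ k → LenR w k ⇔ LenS (θ w) k
  LenR⇔LenS w∈W⁺ k = mk⇔ (λ L → LenR⇒LenS L ≈refl) (λ L → LenS⇒LenR _ w∈W⁺ L ≈refl)

  ReducedR⇒ReducedS : ∀ {w} a → ReducedR w a → ReducedS (θ w) (Θ a)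
  ReducedR⇒ReducedS {w} a (a≈w , L) =
    expRs≈⇒expSs≈ a a≈w , subst (LenS (θ w)) (sym (length-ΘAt true a)) (LenR⇒LenS L ≈refl)

  ReducedS⇒ReducedR : ∀ {w} b → InW⁺ w → ReducedS (θ w) b → ReducedR w (Θ⁻¹ b)
  ReducedS⇒ReducedR {w} b w∈W⁺ (b≈θw , L) =
    expSs≈⇒expRs≈ b w∈W⁺ b≈θw , subst (LenR w) (sym (length-Θ⁻¹At true b)) (LenS⇒LenR w w∈W⁺ L ≈refl)

  DescentsCorrespond : Word → Bool → Set
  DescentsCorrespond w o =
      (∀ x → DesR w x ⇔ DesS (θ w) (φ o x))
    × (∀ s → DesS (θ w) s → ∃ λ x → DesR w x × φ o x ≡ s)

  descents-correspond : ∀ {w} → InW⁺ w → DescentsCorrespond w (even₀ w)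
  descents-correspond {w} w∈W⁺ =
    (λ x → mk⇔ (to x) (from x)) ,
    λ s d → φ⁻¹ o s , from (φ⁻¹ o s) (subst (DesS (θ w)) (sym (φ-φ⁻¹ o s)) d) , φ-φ⁻¹ o s
    where
    o = even₀ w
    to : ∀ x → DesR w x → DesS (θ w) (φ o x)
    to x (k , k′ , L , L′ , k′<k) =
      k , k′ , LenR⇒LenS L ≈refl , LenR⇒LenS L′ (θ-++-expR w x) , k′<k
    from : ∀ x → DesS (θ w) (φ o x) → DesR w x
    from x (k , k′ , L , L′ , k′<k) =
      k , k′ , LenS⇒LenR w w∈W⁺ L ≈refl ,
      LenS⇒LenR (w ++ expR x) (InW⁺-++ {w} w∈W⁺ (InW⁺-expR x)) L′ (θ-++-expR w x) , k′<k

  ≤RW⇒≤W' : ∀ {w v} → w ≤RW v → θ w ≤W' θ v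
  ≤RW⇒≤W' (rw-refl w≈v) = w'-refl (θ-cong w≈v)
  ≤RW⇒≤W' (rw-step {v = v} w≤v x k L L′ vx≈u) =
    w'-step (≤RW⇒≤W' w≤v) (φ (even₀ v) x) k (LenR⇒LenS L ≈refl) (LenR⇒LenS L′ (θ-++-expR v x))
            (≈trans (≈sym (θ-++-expR v x)) (θ-cong vx≈u))

  ≤W'⇒≤RW : ∀ {x y w v} → x ≤W' y → InW⁺ w → InW⁺ v → θ w ≈ x → y ≈ θ v → w ≤RW v
  ≤W'⇒≤RW (w'-refl x≈y) w∈W⁺ v∈W⁺ θw≈x y≈θv =
    rw-refl (θ-injective w∈W⁺ v∈W⁺ (≈trans θw≈x (≈trans x≈y y≈θv)))
  ≤W'⇒≤RW (w'-step {v = v′} x≤v′ s k L@((b , _ , b≈v′) , _) L′ v′s≈y) w∈W⁺ v∈W⁺ θw≈x y≈θv =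
    rw-step (≤W'⇒≤RW x≤v′ w∈W⁺ u∈W⁺ θw≈x (≈sym θu≈v′)) x k
            (LenS⇒LenR u u∈W⁺ L θu≈v′) (LenS⇒LenR (u ++ expR x) ux∈W⁺ L′ θux≈v′s)
            (θ-injective ux∈W⁺ v∈W⁺ (≈trans θux≈v′s (≈trans v′s≈y y≈θv)))
    where
    u = expRs (Θ⁻¹ b)
    u∈W⁺ = InW⁺-expRs (Θ⁻¹ b)
    θu≈v′ = ≈trans (θ-expRs-Θ⁻¹ b) b≈v′
    x = φ⁻¹ (even₀ u) s
    ux∈W⁺ = InW⁺-++ {u} u∈W⁺ (InW⁺-expR x)
    θux≈v′s : θ (u ++ expR x) ≈ v′ ++ expS s
    θux≈v′s = begin
      θ (u ++ expR x)             ≈⟨ θ-++-expR u x ⟩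
      θ u ++ expS (φ (even₀ u) x) ≡⟨ cong (λ s′ → θ u ++ expS s′) (φ-φ⁻¹ (even₀ u) s) ⟩
      θ u ++ expS s               ≈⟨ ++-congʳ (expS s) θu≈v′ ⟩
      v′ ++ expS s                ∎

  reverse-expS : ∀ s → reverse (expS s) ≡ expS s
  reverse-expS t1    = refl
  reverse-expS t1'   = refl
  reverse-expS (t j) = refl

  expSs-mirror : ∀ xs s → expSs (xs ++ s ∷ reverse xs) ≡ expSs xs ++ (expS s ++ reverse (expSs xs))
  expSs-mirror xs s = trans (concatMap-++ expS xs (s ∷ reverse xs))
    (cong (λ z → expSs xs ++ (expS s ++ z)) (sym (reverse-concatMap expS reverse-expS xs)))

  oddPalindrome⇒reflection : ∀ {c} → OddPalindrome c → IsRefl' (expSs c)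
  oddPalindrome⇒reflection pal with oddPalindrome-split pal
  ... | xs , s , refl = xs , s , ≡⇒≈ (sym (expSs-mirror xs s))

  oddPalindrome⇒IsPal : ∀ {a} → OddPalindrome a → IsPal (expRs a)
  oddPalindrome⇒IsPal {a} (odd , rev) = a , odd , rev , ≈refl

  ≤RS⇒≤B : ∀ {w v} → w ≤RS v → θ w ≤B θ v
  ≤RS⇒≤B (rs-refl w≈v) = b-refl (θ-cong w≈v)
  ≤RS⇒≤B (rs-step {v = v} w≤v p (a , odd , rev , a≈p) k k′ L L′ k<k′ vp≈u) =
    b-step (≤RS⇒≤B w≤v) (expSs (ΘAt o a)) (oddPalindrome⇒reflection (ΘAt-oddPalindrome o (odd , rev)))
           k k′ (LenR⇒LenS L ≈refl) (LenR⇒LenS L′ θvp≈θv-c) k<k′ (≈trans (≈sym θvp≈θv-c) (θ-cong vp≈u))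
    where
    o = even₀ v
    θvp≈θv-c : θ (v ++ p) ≈ θ v ++ expSs (ΘAt o a)
    θvp≈θv-c = ≈trans (θ-cong (++-congˡ v (≈sym a≈p))) (θ-++-expRs v a)

  ≤B⇒≤RS : ∀ {x y w v} → x ≤B y → InW⁺ w → InW⁺ v → θ w ≈ x → y ≈ θ v → w ≤RS v
  ≤B⇒≤RS (b-refl x≈y) w∈W⁺ v∈W⁺ θw≈x y≈θv =
    rs-refl (θ-injective w∈W⁺ v∈W⁺ (≈trans θw≈x (≈trans x≈y y≈θv)))
  ≤B⇒≤RS (b-step {v = v′} x≤v′ q (xs , s , c≈q) k k′ L@((b , _ , b≈v′) , _) L′ k<k′ v′q≈y)
         w∈W⁺ v∈W⁺ θw≈x y≈θv =
    rs-step (≤B⇒≤RS x≤v′ w∈W⁺ u∈W⁺ θw≈x (≈sym θu≈v′)) (expRs a)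
            (oddPalindrome⇒IsPal (Θ⁻¹At-oddPalindrome o (mirror-oddPalindrome xs s))) k k′
            (LenS⇒LenR u u∈W⁺ L θu≈v′) (LenS⇒LenR (u ++ expRs a) ua∈W⁺ L′ θua≈v′q) k<k′
            (θ-injective ua∈W⁺ v∈W⁺ (≈trans θua≈v′q (≈trans v′q≈y y≈θv)))
    where
    u = expRs (Θ⁻¹ b)
    u∈W⁺ = InW⁺-expRs (Θ⁻¹ b)
    θu≈v′ = ≈trans (θ-expRs-Θ⁻¹ b) b≈v′
    o = even₀ u
    c = xs ++ s ∷ reverse xs
    a = Θ⁻¹At o c
    ua∈W⁺ = InW⁺-++ {u} u∈W⁺ (InW⁺-expRs a)
    θua≈v′q : θ (u ++ expRs a) ≈ v′ ++ q
    θua≈v′q = begin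
      θ (u ++ expRs a)                                 ≈⟨ θ-++-expRs u a ⟩
      θ u ++ expSs (ΘAt o a)                           ≡⟨ cong (λ c′ → θ u ++ expSs c′) (ΘAt-Θ⁻¹At o c) ⟩
      θ u ++ expSs c                                   ≈⟨ ++-congʳ (expSs c) θu≈v′ ⟩
      v′ ++ expSs c                                    ≡⟨ cong (v′ ++_) (expSs-mirror xs s) ⟩
      v′ ++ (expSs xs ++ (expS s ++ reverse (expSs xs))) ≈⟨ ++-congˡ v′ c≈q ⟩
      v′ ++ q                                          ∎

corollary5p5 : (n : ℕ) (m : CoxMatrix n) → IsCoxeterMatrix m → EvenLeaf m →
    let open Cox m in
    -- (i)-(iii), for every w ∈ W⁺
    (∀ w → InW⁺ w →
        -- (i)
        (∀ k → LenR w k ⇔ LenS (θ w) k)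
        -- (ii) Θ is a bijection  {reduced R∪R⁻¹-words of w} → {reduced S'-words of θ(w)}
      × (∀ a → ReducedR w a → ReducedS (θ w) (Θ a))
      × (∀ a b → ReducedR w a → ReducedR w b → Θ a ≡ Θ b → a ≡ b)
      × (∀ b → ReducedS (θ w) b → ∃ λ a → ReducedR w a × Θ a ≡ b)
        -- (iii) with k = ℓ(w), φ maps Des(w) bijectively onto Des_{S'}(θ(w))
      × (∀ k → LenR w k →
            (∀ x → DesR w x ⇔ DesS (θ w) (φ (isEven k) x))
          × (∀ s → DesS (θ w) s → ∃ λ x → DesR w x × φ (isEven k) x ≡ s)))
    -- θ is a well-defined bijection W⁺ → W'
    × (∀ w v → InW⁺ w → InW⁺ v → w ≈ v → θ w ≈ θ v)
    × (∀ w v → InW⁺ w → InW⁺ v → θ w ≈ θ v → w ≈ v)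
    × (∀ w → InW⁺ w → InW' (θ w))
    × (∀ u → InW' u → ∃ λ w → InW⁺ w × θ w ≈ u)
    -- (iv) order isomorphism for right weak orders
    × (∀ w v → InW⁺ w → InW⁺ v → (w ≤RW v) ⇔ (θ w ≤W' θ v))
    -- (v) order isomorphism  (W⁺, ≤RS) ≅ (W', Bruhat)
    × (∀ w v → InW⁺ w → InW⁺ v → (w ≤RS v) ⇔ (θ w ≤B θ v))
corollary5p5 n m cm el =
  (λ w w∈W⁺ →
      LenR⇔LenS w∈W⁺
    , ReducedR⇒ReducedS
    , (λ a b _ _ → ΘAt-injective true)
    , (λ b R → Θ⁻¹ b , ReducedS⇒ReducedR b w∈W⁺ R , ΘAt-Θ⁻¹At true b)
    , (λ k L → subst (DescentsCorrespond w) (sym (LenR-parity L)) (descents-correspond w∈W⁺)))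
  , (λ w v _ _ → θ-cong)
  , (λ w v → θ-injective)
  , (λ w _ → θ-InW' w)
  , (λ u → θ-surjective)
  , (λ w v w∈W⁺ v∈W⁺ → mk⇔ ≤RW⇒≤W' (λ θw≤θv → ≤W'⇒≤RW θw≤θv w∈W⁺ v∈W⁺ ≈refl ≈refl))
  , (λ w v w∈W⁺ v∈W⁺ → mk⇔ ≤RS⇒≤B (λ θw≤θv → ≤B⇒≤RS θw≤θv w∈W⁺ v∈W⁺ ≈refl ≈refl))
  where
  open Cox m
  open Translation m
  open EvenLeafTranslation cm el
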